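{- A finite simple graph $G$ is a proper $k$-color-line graph if and only if $G$ admits a vertex clique partition $V(G)=Q_1\cup\dots\cup Q_k$ such that the graph $G\setminus\big(\bigcup_{1\le i\le k}E(Q_i)\big)$, obtained from $G$ by deleting all edges with both endpoints in a common $Q_i$, is a line graph.
   Context: A vertex clique partition $V(G)=Q_1\cup\dots\cup Q_k$ means the $Q_i$ are pairwise disjoint cliques of $G$ (sets of pairwise adjacent vertices) whose union is $V(G)$. An edge $k$-coloring of a graph $H$ is a map $\phi:E(H)\to\{1,\dots,k\}$; it is proper if any two distinct edges sharing an endvertex get different colors. For an edge-colored graph $(H,\phi)$, the color-line graph $\mathrm{CL}(H)$ has vertex set $E(H)$, two distinct vertices being adjacent iff the corresponding edges of $H$ share an endvertex or have the same color. $G$ is a proper $k$-color-line graph if $G\cong\mathrm{CL}(H)$ for some graph $H$ with a proper edge $k$-coloring. The line graph $L(H)$ has vertex set $E(H)$, two edges adjacent iff they share an endvertex; a line graph is a graph isomorphic to some $L(H)$. $E(Q)$ denotes the set of edges of $G$ with both endpoints in $Q$. -}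

module Defs where

open import Data.Nat using (ℕ)
open import Data.Fin using (Fin; _<_)
open import Data.Bool using (Bool; T; _∧_; not)
open import Data.Fin.Properties using () renaming (_≟_ to _≟ᶠ_)
open import Relation.Nullary.Decidable using (⌊_⌋)
open import Data.Product using (Σ; Σ-syntax; _×_; _,_; ∃; ∃-syntax; proj₁; proj₂)
open import Data.Sum using (_⊎_)
open import Data.Empty using (⊥)
open import Relation.Nullary using (¬_)
open import Relation.Binary.PropositionalEquality using (_≡_; _≢_)
open import Function.Bundles using (_⤖_; _⇔_; Bijection)

record Graph : Set where
  field
    n     : ℕ
    adj   : Fin n → Fin n → Bool
    sym   : ∀ u v → adj u v ≡ adj v u
    irrefl : ∀ u → adj u u ≡ Data.Bool.false

open Graph public

V : Graph → Set
V G = Fin (n G)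

Adj : (G : Graph) → V G → V G → Set
Adj G u v = T (adj G u v)

-- Edges of a graph: unordered pairs {i,j} represented uniquely with i < j.
Edge : Graph → Set
Edge H = Σ[ i ∈ V H ] Σ[ j ∈ V H ] (i < j × Adj H i j)

end₁ end₂ : (H : Graph) → Edge H → V H
end₁ H e = proj₁ e
end₂ H e = proj₁ (proj₂ e)

ShareEnd : (H : Graph) → Edge H → Edge H → Set
ShareEnd H e f =
  (end₁ H e ≡ end₁ H f) ⊎ (end₁ H e ≡ end₂ H f) ⊎
  (end₂ H e ≡ end₁ H f) ⊎ (end₂ H e ≡ end₂ H f)

EdgeColoring : Graph → ℕ → Set
EdgeColoring H k = Edge H → Fin k

Proper : (H : Graph) (k : ℕ) → EdgeColoring H k → Set
Proper H k φ = ∀ e f → e ≢ f → ShareEnd H e f → φ e ≢ φ f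

LAdj : (H : Graph) → Edge H → Edge H → Set
LAdj H e f = e ≢ f × ShareEnd H e f

CLAdj : (H : Graph) (k : ℕ) → EdgeColoring H k → Edge H → Edge H → Set
CLAdj H k φ e f = e ≢ f × (ShareEnd H e f ⊎ φ e ≡ φ f)

IsoTo : (G : Graph) (X : Set) → (X → X → Set) → Set
IsoTo G X R = Σ[ σ ∈ (V G ⤖ X) ]
  (∀ u v → Adj G u v ⇔ R (Bijection.to σ u) (Bijection.to σ v))

IsProperColorLine : ℕ → Graph → Set
IsProperColorLine k G =
  Σ[ H ∈ Graph ] Σ[ φ ∈ EdgeColoring H k ]
    (Proper H k φ × IsoTo G (Edge H) (CLAdj H k φ))

IsLineGraph : Graph → Set
IsLineGraph G = Σ[ H ∈ Graph ] IsoTo G (Edge H) (LAdj H)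

-- Vertex clique partition V(G) = Q_1 ∪ … ∪ Q_k, encoded by the map
-- sending each vertex to the index of its (unique) part; parts may be empty.
IsCliquePartition : (G : Graph) (k : ℕ) → (V G → Fin k) → Set
IsCliquePartition G k q = ∀ u v → u ≢ v → q u ≡ q v → Adj G u v

private
  samePart : ∀ {m k} → (Fin m → Fin k) → Fin m → Fin m → Bool
  samePart q u v = ⌊ q u ≟ᶠ q v ⌋

  andSym : ∀ a b c d → a ≡ b → c ≡ d → (a ∧ not c) ≡ (b ∧ not d)
  andSym a .a c .c Relation.Binary.PropositionalEquality.refl Relation.Binary.PropositionalEquality.refl = Relation.Binary.PropositionalEquality.refl

  dsym : ∀ {k} (x y : Fin k) → ⌊ x ≟ᶠ y ⌋ ≡ ⌊ y ≟ᶠ x ⌋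
  dsym x y with x ≟ᶠ y | y ≟ᶠ x
  ... | Relation.Nullary.yes _ | Relation.Nullary.yes _ = Relation.Binary.PropositionalEquality.refl
  ... | Relation.Nullary.no _  | Relation.Nullary.no _  = Relation.Binary.PropositionalEquality.refl
  ... | Relation.Nullary.yes p | Relation.Nullary.no ¬q = Data.Empty.⊥-elim (¬q (Relation.Binary.PropositionalEquality.sym p))
  ... | Relation.Nullary.no ¬p | Relation.Nullary.yes q = Data.Empty.⊥-elim (¬p (Relation.Binary.PropositionalEquality.sym q))

  irr : ∀ (b c : Bool) → b ≡ Data.Bool.false → (b ∧ c) ≡ Data.Bool.false
  irr .Data.Bool.false c Relation.Binary.PropositionalEquality.refl = Relation.Binary.PropositionalEquality.refl

deletePartEdges : (G : Graph) (k : ℕ) → (V G → Fin k) → Graph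
deletePartEdges G k q = record
  { n = n G
  ; adj = λ u v → adj G u v ∧ not (samePart q u v)
  ; sym = λ u v → andSym _ _ _ _ (sym G u v) (dsym (q u) (q v))
  ; irrefl = λ u → irr (adj G u u) _ (irrefl G u)
  }

-- Both sides are witnessed by the same graph H and the same bijection
-- σ : V(G) → E(H); the edge colouring φ of H and the partition q of G
-- determine each other through q = φ ∘ σ. In CL(H) two edges are adjacent
-- iff they share an end or have the same colour, so the parts of q are
-- cliques of G, and deleting the edges inside the parts leaves exactly the
-- adjacency of L(H) precisely when no two edges sharing an end have the
-- same colour, i.e. when φ is proper.
module Submission where

open import Defs hiding (sym)
open import Data.Nat using (ℕ)
open import Data.Fin using (Fin)
open import Data.Fin.Properties using () renaming (_≟_ to _≟ᶠ_)
open import Data.Bool using (T; not)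
open import Data.Bool.Properties using (T-∧)
open import Data.Product using (Σ-syntax; _×_; _,_; proj₁; proj₂)
open import Data.Product.Function.NonDependent.Propositional using (_×-⇔_)
open import Data.Sum using (inj₁; inj₂)
open import Data.Empty using (⊥-elim)
open import Relation.Nullary using (¬_; Dec; yes; no)
open import Relation.Nullary.Decidable using (⌊_⌋)
open import Relation.Binary.PropositionalEquality using (_≡_; _≢_; refl; sym; trans; cong; subst)
open import Function.Base using (_∘_)
open import Function.Bundles using (_⇔_; mk⇔; Equivalence; Bijection; _⤖_)
open import Function.Construct.Composition using (_⇔-∘_)
open import Function.Construct.Identity using (⇔-id)

T-not-⌊⌋ : ∀ {P : Set} (P? : Dec P) → T (not ⌊ P? ⌋) ⇔ (¬ P)
T-not-⌊⌋ (yes p) = mk⇔ (λ ()) (λ ¬p → ¬p p)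
T-not-⌊⌋ (no ¬p) = mk⇔ (λ _ → ¬p) _

Adj-deletePartEdges : ∀ (G : Graph) k (q : V G → Fin k) u v →
  Adj (deletePartEdges G k q) u v ⇔ (Adj G u v × q u ≢ q v)
Adj-deletePartEdges G k q u v = (⇔-id _ ×-⇔ T-not-⌊⌋ (q u ≟ᶠ q v)) ⇔-∘ T-∧

Adj⇒≢ : ∀ (G : Graph) {u v} → Adj G u v → u ≢ v
Adj⇒≢ G {u} a refl = subst T (irrefl G u) a

module _ {k : ℕ} (G H : Graph) (σ : V G ⤖ Edge H)
         (φ : EdgeColoring H k) (q : V G → Fin k)
         (q≗φ∘σ : ∀ u → q u ≡ φ (Bijection.to σ u)) where

  open Bijection σ using (to; injective; strictlySurjective)
  open Equivalence using () renaming (to to ⇒; from to ⇐)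

  ColorLineIso LineIso : Set
  ColorLineIso = ∀ u v → Adj G u v ⇔ CLAdj H k φ (to u) (to v)
  LineIso      = ∀ u v → Adj (deletePartEdges G k q) u v ⇔ LAdj H (to u) (to v)

  private
    Adj-G∖Q : ∀ u v → Adj (deletePartEdges G k q) u v ⇔ (Adj G u v × q u ≢ q v)
    Adj-G∖Q = Adj-deletePartEdges G k q

  samePart⇒sameColour : ∀ {u v} → q u ≡ q v → φ (to u) ≡ φ (to v)
  samePart⇒sameColour {u} {v} eq = trans (sym (q≗φ∘σ u)) (trans eq (q≗φ∘σ v))

  sameColour⇒samePart : ∀ {u v} → φ (to u) ≡ φ (to v) → q u ≡ q v
  sameColour⇒samePart {u} {v} eq = trans (q≗φ∘σ u) (trans eq (sym (q≗φ∘σ v)))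

  colorLineIso⇒cliquePartition : ColorLineIso → IsCliquePartition G k q
  colorLineIso⇒cliquePartition iso u v u≢v same =
    ⇐ (iso u v) (u≢v ∘ injective , inj₂ (samePart⇒sameColour same))

  colorLineIso⇒lineIso : Proper H k φ → ColorLineIso → LineIso
  colorLineIso⇒lineIso proper iso u v = mk⇔ forward backward
    where
    forward : Adj (deletePartEdges G k q) u v → LAdj H (to u) (to v)
    forward a with ⇒ (Adj-G∖Q u v) a
    ... | a′ , differentParts with ⇒ (iso u v) a′
    ... | e≢f , inj₁ shared = e≢f , shared
    ... | e≢f , inj₂ same   = ⊥-elim (differentParts (sameColour⇒samePart same))

    backward : LAdj H (to u) (to v) → Adj (deletePartEdges G k q) u v
    backward (e≢f , shared) = ⇐ (Adj-G∖Q u v)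
      (⇐ (iso u v) (e≢f , inj₁ shared) , proper _ _ e≢f shared ∘ samePart⇒sameColour)

  lineIso⇒proper : LineIso → Proper H k φ
  lineIso⇒proper iso e f e≢f shared same with strictlySurjective e | strictlySurjective f
  ... | u , refl | v , refl =
    proj₂ (⇒ (Adj-G∖Q u v) (⇐ (iso u v) (e≢f , shared))) (sameColour⇒samePart same)

  lineIso⇒colorLineIso : IsCliquePartition G k q → LineIso → ColorLineIso
  lineIso⇒colorLineIso clique iso u v = mk⇔ forward backward
    where
    forward : Adj G u v → CLAdj H k φ (to u) (to v)
    forward a with q u ≟ᶠ q v
    ... | yes same = Adj⇒≢ G a ∘ injective , inj₂ (samePart⇒sameColour same)
    ... | no differentParts =
      let e≢f , shared = ⇒ (iso u v) (⇐ (Adj-G∖Q u v) (a , differentParts))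
      in e≢f , inj₁ shared

    backward : CLAdj H k φ (to u) (to v) → Adj G u v
    backward (e≢f , inj₁ shared) = proj₁ (⇒ (Adj-G∖Q u v) (⇐ (iso u v) (e≢f , shared)))
    backward (e≢f , inj₂ same)   = clique u v (e≢f ∘ cong to) (sameColour⇒samePart same)

theorem7 : (k : ℕ) (G : Graph) →
    IsProperColorLine k G ⇔
      (Σ[ q ∈ (V G → Fin k) ] (IsCliquePartition G k q × IsLineGraph (deletePartEdges G k q)))
theorem7 k G = mk⇔ toPartition fromPartition
  where
  toPartition : IsProperColorLine k G →
    Σ[ q ∈ (V G → Fin k) ] (IsCliquePartition G k q × IsLineGraph (deletePartEdges G k q))
  toPartition (H , φ , proper , σ , iso) =
    q , colorLineIso⇒cliquePartition G H σ φ q (λ _ → refl) iso ,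
    H , σ , colorLineIso⇒lineIso G H σ φ q (λ _ → refl) proper iso
    where
    q : V G → Fin k
    q = φ ∘ Bijection.to σ

  fromPartition :
    Σ[ q ∈ (V G → Fin k) ] (IsCliquePartition G k q × IsLineGraph (deletePartEdges G k q)) →
    IsProperColorLine k G
  fromPartition (q , clique , H , σ , iso) =
    H , φ , lineIso⇒proper G H σ φ q q≗φ∘σ iso ,
    σ , lineIso⇒colorLineIso G H σ φ q q≗φ∘σ clique iso
    where
    open Bijection σ using (to; to⁻; strictlySurjective; injective)
    φ : EdgeColoring H k
    φ = q ∘ to⁻
    q≗φ∘σ : ∀ u → q u ≡ φ (to u)
    q≗φ∘σ u = cong q (sym (injective (proj₂ (strictlySurjective (to u)))))
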